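{- Let $n>8$ and let $G$ be a divisible design graph with parameters $(4n,3n-2,3n-6,2n-2,4,n)$. Then the classes of its canonical partition can be numbered so that its quotient matrix $R$ equals one of the following three matrices: $$\begin{pmatrix} n-1&1&n-1&n-1\\ 1&n-1&n-1&n-1\\ n-1&n-1&n-1&1\\ n-1&n-1&1&n-1\end{pmatrix},\quad \begin{pmatrix} n-1&1&n-1&n-1\\ 1&n-1&n-1&n-1\\ n-1&n-1&1&n-1\\ n-1&n-1&n-1&1\end{pmatrix},\quad \begin{pmatrix} 1&n-1&n-1&n-1\\ n-1&1&n-1&n-1\\ n-1&n-1&1&n-1\\ n-1&n-1&n-1&1\end{pmatrix}.$$
   Context: A divisible design graph (DDG) with parameters $(v,k,\lambda_1,\lambda_2,m,n)$ is a $k$-regular graph on $v=mn$ vertices whose vertex set can be partitioned into $m$ classes of size $n$ (a canonical partition) such that any two distinct vertices in the same class have exactly $\lambda_1$ common neighbours and any two vertices in different classes have exactly $\lambda_2$ common neighbours. For $\lambda_1\neq\lambda_2$ the canonical partition is equitable: each vertex of class $V_i$ has the same number $r_{ij}$ of neighbours in class $V_j$; $R=(r_{ij})$ is the quotient matrix. -}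

module Defs where

open import Data.Nat using (ℕ; zero; suc; _+_; _*_; _∸_)
open import Data.Bool using (Bool; true; false; _∧_; if_then_else_)
open import Data.Fin using (Fin; zero; suc; _≟_)
open import Data.Fin.Permutation using (Permutation′; _⟨$⟩ʳ_)
open import Data.Product using (_×_; Σ; _,_)
open import Data.Sum using (_⊎_)
open import Relation.Nullary using (¬_)
open import Relation.Nullary.Decidable using (⌊_⌋)
open import Relation.Binary.PropositionalEquality using (_≡_)

count : {v : ℕ} → (Fin v → Bool) → ℕ
count {zero} p = 0
count {suc v} p = (if p zero then 1 else 0) + count (λ i → p (suc i))

record Graph (v : ℕ) : Set where
  field
    adj     : Fin v → Fin v → Bool
    symm    : ∀ x y → adj x y ≡ adj y x
    irrefl  : ∀ x → adj x x ≡ false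

open Graph public

degree : {v : ℕ} → Graph v → Fin v → ℕ
degree G x = count (λ z → adj G x z)

common : {v : ℕ} → Graph v → Fin v → Fin v → ℕ
common G x y = count (λ z → adj G x z ∧ adj G y z)

record IsDDG {v : ℕ} (G : Graph v) (k λ₁ λ₂ m n : ℕ) (cls : Fin v → Fin m) : Set where
  field
    order      : v ≡ m * n
    classSize  : ∀ (i : Fin m) → count (λ x → ⌊ cls x ≟ i ⌋) ≡ n
    regular    : ∀ x → degree G x ≡ k
    sameClass  : ∀ x y → ¬ (x ≡ y) → cls x ≡ cls y → common G x y ≡ λ₁
    diffClass  : ∀ x y → ¬ (cls x ≡ cls y) → common G x y ≡ λ₂

nbrsIn : {v m : ℕ} → Graph v → (Fin v → Fin m) → Fin v → Fin m → ℕ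
nbrsIn G cls x j = count (λ z → adj G x z ∧ ⌊ cls z ≟ j ⌋)

-- after renumbering the classes by σ (new class i is old class σ i), the
-- quotient matrix of the partition is M: every vertex of class i has
-- exactly M i j neighbours in class j
HasQuotientMatrix : {v m : ℕ} → Graph v → (Fin v → Fin m) →
                    Permutation′ m → (Fin m → Fin m → ℕ) → Set
HasQuotientMatrix G cls σ M =
  ∀ i j x → cls x ≡ σ ⟨$⟩ʳ i → nbrsIn G cls x (σ ⟨$⟩ʳ j) ≡ M i j

mat4 : {A : Set} → A → A → A → A → A → A → A → A → A → A → A → A → A → A → A → A
     → Fin 4 → Fin 4 → A
mat4 a b c d _ _ _ _ _ _ _ _ _ _ _ _ zero zero = a
mat4 a b c d _ _ _ _ _ _ _ _ _ _ _ _ zero (suc zero) = b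
mat4 a b c d _ _ _ _ _ _ _ _ _ _ _ _ zero (suc (suc zero)) = c
mat4 a b c d _ _ _ _ _ _ _ _ _ _ _ _ zero (suc (suc (suc zero))) = d
mat4 _ _ _ _ a b c d _ _ _ _ _ _ _ _ (suc zero) zero = a
mat4 _ _ _ _ a b c d _ _ _ _ _ _ _ _ (suc zero) (suc zero) = b
mat4 _ _ _ _ a b c d _ _ _ _ _ _ _ _ (suc zero) (suc (suc zero)) = c
mat4 _ _ _ _ a b c d _ _ _ _ _ _ _ _ (suc zero) (suc (suc (suc zero))) = d
mat4 _ _ _ _ _ _ _ _ a b c d _ _ _ _ (suc (suc zero)) zero = a
mat4 _ _ _ _ _ _ _ _ a b c d _ _ _ _ (suc (suc zero)) (suc zero) = b
mat4 _ _ _ _ _ _ _ _ a b c d _ _ _ _ (suc (suc zero)) (suc (suc zero)) = c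
mat4 _ _ _ _ _ _ _ _ a b c d _ _ _ _ (suc (suc zero)) (suc (suc (suc zero))) = d
mat4 _ _ _ _ _ _ _ _ _ _ _ _ a b c d (suc (suc (suc zero))) zero = a
mat4 _ _ _ _ _ _ _ _ _ _ _ _ a b c d (suc (suc (suc zero))) (suc zero) = b
mat4 _ _ _ _ _ _ _ _ _ _ _ _ a b c d (suc (suc (suc zero))) (suc (suc zero)) = c
mat4 _ _ _ _ _ _ _ _ _ _ _ _ a b c d (suc (suc (suc zero))) (suc (suc (suc zero))) = d

R₁ R₂ R₃ : ℕ → Fin 4 → Fin 4 → ℕ
R₁ n = let a = n ∸ 1 in
  mat4 a 1 a a
       1 a a a
       a a a 1
       a a 1 a
R₂ n = let a = n ∸ 1 in
  mat4 a 1 a a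
       1 a a a
       a a 1 a
       a a a 1
R₃ n = let a = n ∸ 1 in
  mat4 1 a a a
       a 1 a a
       a a 1 a
       a a a 1

-- Write N x j for the number of neighbours of x in class j. Since λ₁ ≠ λ₂, the
-- symmetry of A³, expanded via A² = kI + λ₁(K - I) + λ₂(J - K) with K the
-- indicator matrix of "same class" and J the all-ones matrix, gives
-- N x (cls y) = N y (cls x); in particular the partition is equitable. Counting
-- walks from x back into its own class gives Σⱼ (N x j)² = k + λ₁ (n - 1), while
-- Σⱼ N x j = k. For the given parameters the numbers uⱼ = n - N x j satisfy
-- Σ uⱼ = n + 2 and Σ uⱼ² = (n - 1)² + 3, which for n > 8 forces (uⱼ) to be a
-- permutation of (n - 1, 1, 1, 1). So the vertices of each class i have a single
-- neighbour in one class π i and n - 1 neighbours in each other class; symmetry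
-- makes π an involution, and the three conjugacy classes of involutions of a
-- 4-element set give the three matrices.

{-# OPTIONS --safe #-}
module Submission where

open import Defs
open import Data.Nat using (ℕ; _+_; _*_; _∸_; _>_)
open import Data.Fin using (Fin)
open import Data.Fin.Permutation using (Permutation′)
open import Data.Product using (Σ)
open import Data.Sum using (_⊎_)

open import Data.Bool using (Bool; true; false; _∧_; if_then_else_; T)
open import Data.Bool.Properties using (∧-idem)
open import Data.Fin using (zero; suc; _≟_; punchIn)
open import Data.Fin.Patterns using (0F; 1F; 2F; 3F)
open import Data.Fin.Permutation using (_⟨$⟩ʳ_; id; transpose; _∘ₚ_)
open import Data.Fin.Properties using (all?; punchInᵢ≢i; punchIn-punchOut)
open import Data.List using (List; []; _∷_)
open import Data.List.Relation.Unary.Any using (Any; any?; satisfied)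
open import Data.Nat using (zero; suc; _≤_; _<_; z≤n; s≤s; _≤?_; ≤-pred)
open import Data.Nat.Properties hiding (_≟_)
open import Data.Nat.Tactic.RingSolver using (solve-∀)
open import Algebra.Properties.Semiring.Sum +-*-semiring
  using (sum; sum-cong-≗; ∑-distrib-+; ∑-comm; *-distribˡ-sum; sum-remove; sum-replicate-zero)
open import Data.Product using (∃; _×_; _,_; proj₁; proj₂)
open import Data.Sum using (inj₁; inj₂)
import Data.Sum as Sum
open import Data.Unit using (tt)
open import Data.Vec using (_∷_; []; lookup; tabulate)
open import Data.Vec.Functional using (removeAt)
open import Data.Vec.Properties using (lookup∘tabulate)
open import Function using (_∘_)
open import Function.Bundles using (Injection)
open import Function.Properties.Inverse using (↔⇒↣)
open import Relation.Nullary using (yes; no)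
open import Relation.Nullary.Decidable using (Dec; ⌊_⌋; toWitness; decidable-stable; _⊎-dec_; _→-dec_)
open import Relation.Nullary.Negation using (contradiction)
open import Relation.Binary.PropositionalEquality
open import Algebra.Definitions {A = Fin 4} _≡_ using (Involutive)

χ : Bool → ℕ
χ b = if b then 1 else 0

χ-∧ : ∀ a b → χ (a ∧ b) ≡ χ a * χ b
χ-∧ false b = refl
χ-∧ true  b = sym (+-identityʳ (χ b))

χ-*-≤ : ∀ b c → χ b * c ≤ c
χ-*-≤ false c = z≤n
χ-*-≤ true  c = ≤-reflexive (+-identityʳ c)

χ-≟-refl : ∀ {v} (y : Fin v) → χ ⌊ y ≟ y ⌋ ≡ 1
χ-≟-refl y with y ≟ y
... | yes _   = refl
... | no y≢y = contradiction refl y≢y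

χ-≟-≢ : ∀ {v} {y z : Fin v} → y ≢ z → χ ⌊ y ≟ z ⌋ ≡ 0
χ-≟-≢ {y = y} {z} y≢z with y ≟ z
... | yes y≡z = contradiction y≡z y≢z
... | no _    = refl

count≡∑χ : ∀ {v} (p : Fin v → Bool) → count p ≡ sum (χ ∘ p)
count≡∑χ {zero}  p = refl
count≡∑χ {suc v} p = cong (χ (p zero) +_) (count≡∑χ (p ∘ suc))

0<count⇒∃ : ∀ {v} (p : Fin v → Bool) → 0 < count p → ∃ λ x → T (p x)
0<count⇒∃ {zero}  p ()
0<count⇒∃ {suc v} p 0<count with p zero in p₀≡
... | true  = zero , subst T (sym p₀≡) tt
... | false = let x , px = 0<count⇒∃ (p ∘ suc) 0<count in suc x , px

∑-mono-≤ : ∀ {v} {f g : Fin v → ℕ} → (∀ i → f i ≤ g i) → sum f ≤ sum g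
∑-mono-≤ {zero}  f≤g = z≤n
∑-mono-≤ {suc v} f≤g = +-mono-≤ (f≤g zero) (∑-mono-≤ (f≤g ∘ suc))

∑-const : ∀ v c → sum {v} (λ _ → c) ≡ v * c
∑-const zero    c = refl
∑-const (suc v) c = cong (c +_) (∑-const v c)

∑-*ˡ : ∀ {v} c (f : Fin v → ℕ) → sum (λ i → c * f i) ≡ c * sum f
∑-*ˡ c f = sym (*-distribˡ-sum c f)

∑-+-*ˡ : ∀ {v} (f g : Fin v → ℕ) c → sum (λ i → f i + c * g i) ≡ sum f + c * sum g
∑-+-*ˡ f g c = trans (∑-distrib-+ f (λ i → c * g i)) (cong (sum f +_) (∑-*ˡ c g))

∑-linear₃ : ∀ {v} (f g h : Fin v → ℕ) b c → sum (λ i → f i + b * g i + c * h i) ≡ sum f + b * sum g + c * sum h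
∑-linear₃ f g h b c = trans (∑-+-*ˡ (λ i → f i + b * g i) h c) (cong (_+ c * sum h) (∑-+-*ˡ f g b))

∑-sift : ∀ {v} (f : Fin v → ℕ) y → sum (λ z → f z * χ ⌊ y ≟ z ⌋) ≡ f y
∑-sift {suc v} f y = begin
  sum (λ z → f z * χ ⌊ y ≟ z ⌋)                                  ≡⟨ sum-remove {i = y} (λ z → f z * χ ⌊ y ≟ z ⌋) ⟩
  f y * χ ⌊ y ≟ y ⌋ + sum (removeAt (λ z → f z * χ ⌊ y ≟ z ⌋) y) ≡⟨ cong₂ _+_ (cong (f y *_) (χ-≟-refl y))
                                                                         (trans (sum-cong-≗ off) (sum-replicate-zero v)) ⟩
  f y * 1 + 0                                                     ≡⟨ trans (+-identityʳ _) (*-identityʳ (f y)) ⟩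
  f y                                                             ∎
  where
  open ≡-Reasoning
  off : ∀ j → f (punchIn y j) * χ ⌊ y ≟ punchIn y j ⌋ ≡ 0
  off j = trans (cong (f (punchIn y j) *_) (χ-≟-≢ (punchInᵢ≢i y j ∘ sym))) (*-zeroʳ (f (punchIn y j)))

∑-δ : ∀ {v} (y : Fin v) → sum (λ z → χ ⌊ y ≟ z ⌋) ≡ 1
∑-δ y = trans (sum-cong-≗ (λ z → sym (*-identityˡ (χ ⌊ y ≟ z ⌋)))) (∑-sift (λ _ → 1) y)

∑-partition : ∀ {v m} (cl : Fin v → Fin m) (h : Fin v → ℕ) →
              sum h ≡ sum (λ t → sum (λ z → h z * χ ⌊ cl z ≟ t ⌋))
∑-partition cl h = trans (sum-cong-≗ (λ z → sym (∑-sift (λ _ → h z) (cl z))))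
                         (∑-comm (λ z t → h z * χ ⌊ cl z ≟ t ⌋))

∑-complement : ∀ {v} c (e : Fin v → ℕ) → (∀ i → e i ≤ c) → sum (λ i → c ∸ e i) + sum e ≡ v * c
∑-complement {v} c e e≤c = begin
  sum (λ i → c ∸ e i) + sum e   ≡⟨ ∑-distrib-+ (λ i → c ∸ e i) e ⟨
  sum (λ i → c ∸ e i + e i)     ≡⟨ sum-cong-≗ (λ i → m∸n+n≡m (e≤c i)) ⟩
  sum {v} (λ _ → c)             ≡⟨ ∑-const v c ⟩
  v * c                         ∎
  where open ≡-Reasoning

∑-complement-sq : ∀ {v} c (e : Fin v → ℕ) → (∀ i → e i ≤ c) →
                  sum (λ i → (c ∸ e i) * (c ∸ e i)) + 2 * c * sum e ≡ v * (c * c) + sum (λ i → e i * e i)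
∑-complement-sq {v} c e e≤c = begin
  sum (λ i → u i * u i) + 2 * c * sum e      ≡⟨ ∑-+-*ˡ (λ i → u i * u i) e (2 * c) ⟨
  sum (λ i → u i * u i + 2 * c * e i)        ≡⟨ sum-cong-≗ (λ i → subst (λ c → u i * u i + 2 * c * e i ≡ c * c + e i * e i)
                                                                   (m∸n+n≡m (e≤c i)) (square-complement (u i) (e i))) ⟩
  sum (λ i → c * c + e i * e i)              ≡⟨ ∑-distrib-+ (λ _ → c * c) (λ i → e i * e i) ⟩
  sum {v} (λ _ → c * c) + sum (λ i → e i * e i) ≡⟨ cong (_+ _) (∑-const v (c * c)) ⟩
  v * (c * c) + sum (λ i → e i * e i)        ∎
  where
  open ≡-Reasoning
  u : _ → ℕ
  u i = c ∸ e i
  square-complement : ∀ u e → u * u + 2 * (u + e) * e ≡ (u + e) * (u + e) + e * e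
  square-complement = solve-∀

∑-sq≤max*∑ : ∀ {v} (u : Fin v → ℕ) M → (∀ i → u i ≤ M) → sum (λ i → u i * u i) ≤ M * sum u
∑-sq≤max*∑ u M u≤M = ≤-trans (∑-mono-≤ (λ i → *-monoˡ-≤ (u i) (u≤M i))) (≤-reflexive (∑-*ˡ M u))

∑-sq≤sq-∑ : ∀ {v} (u : Fin v → ℕ) → sum (λ i → u i * u i) ≤ sum u * sum u
∑-sq≤sq-∑ {zero}  u = z≤n
∑-sq≤sq-∑ {suc v} u = begin
  a * a + sum (λ i → u (suc i) * u (suc i)) ≤⟨ +-monoʳ-≤ (a * a) (∑-sq≤sq-∑ (u ∘ suc)) ⟩
  a * a + s * s                             ≤⟨ m≤m+n (a * a + s * s) (2 * (a * s)) ⟩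
  a * a + s * s + 2 * (a * s)               ≡⟨ square-expand a s ⟩
  (a + s) * (a + s)                         ∎
  where
  open ≤-Reasoning
  a = u zero
  s = sum (u ∘ suc)
  square-expand : ∀ a s → a * a + s * s + 2 * (a * s) ≡ (a + s) * (a + s)
  square-expand = solve-∀

∃-argmax : ∀ {v} (u : Fin (suc v) → ℕ) → ∃ λ t → ∀ i → u i ≤ u t
∃-argmax {zero}  u = zero , λ { zero → ≤-refl }
∃-argmax {suc v} u with ∃-argmax (u ∘ suc)
... | t , max with ≤-total (u zero) (u (suc t))
...   | inj₁ u₀≤ = suc t , λ { zero → u₀≤ ; (suc i) → max i }
...   | inj₂ ≤u₀ = zero  , λ { zero → ≤-refl ; (suc i) → ≤-trans (max i) ≤u₀ }

+-≤-≡⇒≡ˡ : ∀ {a b c d} → a ≤ c → b ≤ d → a + b ≡ c + d → a ≡ c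
+-≤-≡⇒≡ˡ {a} {b} {c} {d} a≤c b≤d a+b≡c+d = ≤-antisym a≤c (+-cancelʳ-≤ b c a (begin
  c + b ≤⟨ +-monoʳ-≤ c b≤d ⟩
  c + d ≡⟨ a+b≡c+d ⟨
  a + b ∎))
  where open ≤-Reasoning

∑-≤-≡⇒≗ : ∀ {v} {f g : Fin v → ℕ} → (∀ i → f i ≤ g i) → sum f ≡ sum g → ∀ i → f i ≡ g i
∑-≤-≡⇒≗ {suc v} f≤g ∑f≡∑g zero    = +-≤-≡⇒≡ˡ (f≤g zero) (∑-mono-≤ (f≤g ∘ suc)) ∑f≡∑g
∑-≤-≡⇒≗ {suc v} f≤g ∑f≡∑g (suc i) =
  ∑-≤-≡⇒≗ (f≤g ∘ suc) (+-cancelˡ-≡ _ _ _ (trans (cong (_+ _) (sym head≡)) ∑f≡∑g)) i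
  where head≡ = ∑-≤-≡⇒≗ f≤g ∑f≡∑g zero

2*≤sq+1 : ∀ w → 2 * w ≤ w * w + 1
2*≤sq+1 zero    = z≤n
2*≤sq+1 (suc u) = ≤-trans (m≤m+n (2 * suc u) (u * u)) (≤-reflexive (square-shift u))
  where
  square-shift : ∀ u → 2 * suc u + u * u ≡ suc u * suc u + 1
  square-shift = solve-∀

sq+1≡2*⇒≡1 : ∀ w → w * w + 1 ≡ 2 * w → w ≡ 1
sq+1≡2*⇒≡1 zero          ()
sq+1≡2*⇒≡1 (suc zero)    _  = refl
sq+1≡2*⇒≡1 (suc (suc u)) eq = contradiction (≤-reflexive (trans (sym (square-shift u)) eq)) (m+1+n≰m _)
  where
  square-shift : ∀ u → suc (suc u) * suc (suc u) + 1 ≡ 2 * suc (suc u) + suc (u * u + 2 * u)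
  square-shift = solve-∀

∑≡∑sq≡size⇒≡1 : ∀ {v} (w : Fin v → ℕ) → sum w ≡ v → sum (λ i → w i * w i) ≡ v → ∀ i → w i ≡ 1
∑≡∑sq≡size⇒≡1 {v} w ∑w≡v ∑w²≡v i = sq+1≡2*⇒≡1 (w i) (sym (∑-≤-≡⇒≗ (λ i → 2*≤sq+1 (w i)) totals i))
  where
  totals : sum (λ i → 2 * w i) ≡ sum (λ i → w i * w i + 1)
  totals = begin
    sum (λ i → 2 * w i)           ≡⟨ ∑-*ˡ 2 w ⟩
    2 * sum w                     ≡⟨ cong (2 *_) ∑w≡v ⟩
    2 * v                         ≡⟨ cong (v +_) (trans (+-identityʳ v) (sym (*-identityʳ v))) ⟩
    v + v * 1                     ≡⟨ cong₂ _+_ (sym ∑w²≡v) (sym (∑-const v 1)) ⟩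
    sum (λ i → w i * w i) + sum {v} (λ _ → 1) ≡⟨ ∑-distrib-+ (λ i → w i * w i) (λ _ → 1) ⟨
    sum (λ i → w i * w i + 1)     ∎
    where open ≡-Reasoning

crossing-shift≡0 : ∀ {a b P Q N} d → a ≢ b → P + b * N ≡ Q + a * N → P + b * (N + d) ≡ Q + a * (N + d) → d ≡ 0
crossing-shift≡0 zero    a≢b e e′ = refl
crossing-shift≡0 {a} {b} {P} {Q} {N} (suc d) a≢b e e′ = contradiction (sym (*-cancelʳ-≡ b a (suc d) bd≡ad)) a≢b
  where
  open ≡-Reasoning
  bd≡ad : b * suc d ≡ a * suc d
  bd≡ad = +-cancelˡ-≡ (Q + a * N) _ _ (begin
    Q + a * N + b * suc d   ≡⟨ cong (_+ b * suc d) e ⟨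
    P + b * N + b * suc d   ≡⟨ +-assoc P (b * N) _ ⟩
    P + (b * N + b * suc d) ≡⟨ cong (P +_) (*-distribˡ-+ b N (suc d)) ⟨
    P + b * (N + suc d)     ≡⟨ e′ ⟩
    Q + a * (N + suc d)     ≡⟨ cong (Q +_) (*-distribˡ-+ a N (suc d)) ⟩
    Q + (a * N + a * suc d) ≡⟨ +-assoc Q (a * N) _ ⟨
    Q + a * N + a * suc d   ∎)

lines-cross-once : ∀ {a b P Q N N′} → a ≢ b → P + b * N ≡ Q + a * N → P + b * N′ ≡ Q + a * N′ → N ≡ N′
lines-cross-once {N = N} {N′} a≢b e e′ with ≤-total N N′
... | inj₁ N≤N′ with d , refl ← m≤n⇒∃[o]m+o≡n N≤N′ =
  sym (trans (cong (N +_) (crossing-shift≡0 d a≢b e e′)) (+-identityʳ N))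
... | inj₂ N′≤N with d , refl ← m≤n⇒∃[o]m+o≡n N′≤N =
  trans (cong (N′ +_) (crossing-shift≡0 d a≢b e′ e)) (+-identityʳ N′)

-- With a = n - 1: M is the largest of four numbers u with Σ u = a + 3 and
-- Σ u² = a² + 3, and s, q are the sum and the sum of squares of the other three.
module _ (p : ℕ) where
  private
    a = 8 + p

  max-lower-bound : ∀ {M s q} → M + s ≡ a + 3 → M * M + q ≡ a * a + 3 → q ≤ M * s → 6 + p ≤ M
  max-lower-bound {M} {s} {q} sum≡ squares≡ q≤Ms with 6 + p ≤? M
  ... | yes 6+p≤M = 6+p≤M
  ... | no  6+p≰M = contradiction (begin
    (5 + p) * (11 + p) + suc 11 ≡⟨ shift p ⟩
    a * a + 3                   ≡⟨ squares≡ ⟨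
    M * M + q                   ≤⟨ +-monoʳ-≤ (M * M) q≤Ms ⟩
    M * M + M * s               ≡⟨ *-distribˡ-+ M M s ⟨
    M * (M + s)                 ≡⟨ cong (M *_) (trans sum≡ (sum-shift p)) ⟩
    M * (11 + p)                ≤⟨ *-monoˡ-≤ (11 + p) (≤-pred (≰⇒> 6+p≰M)) ⟩
    (5 + p) * (11 + p)          ∎) (m+1+n≰m _)
    where
    open ≤-Reasoning
    shift : ∀ p → (5 + p) * (11 + p) + suc 11 ≡ (8 + p) * (8 + p) + 3
    shift = solve-∀
    sum-shift : ∀ p → 8 + p + 3 ≡ 11 + p
    sum-shift = solve-∀

  max-excess≡2 : ∀ r {s q} → r + s ≡ 5 → (6 + p + r) * (6 + p + r) + q ≡ a * a + 3 → q ≤ s * s →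
                 r ≡ 2 × q ≡ 3
  max-excess≡2 0 refl squares≡ q≤s² = contradiction (subst (_≤ 25) q≡ q≤s²) (m+1+n≰m 25)
    where
    q≡ : _ ≡ 31 + 4 * p
    q≡ = +-cancelˡ-≡ _ _ _ (trans squares≡ (e p))
      where e : ∀ p → (8 + p) * (8 + p) + 3 ≡ (6 + p + 0) * (6 + p + 0) + (31 + 4 * p)
            e = solve-∀
  max-excess≡2 1 refl squares≡ q≤s² = contradiction (subst (_≤ 16) q≡ q≤s²) (m+1+n≰m 16)
    where
    q≡ : _ ≡ 18 + 2 * p
    q≡ = +-cancelˡ-≡ _ _ _ (trans squares≡ (e p))
      where e : ∀ p → (8 + p) * (8 + p) + 3 ≡ (6 + p + 1) * (6 + p + 1) + (18 + 2 * p)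
            e = solve-∀
  max-excess≡2 2 refl squares≡ q≤s² = refl , +-cancelˡ-≡ _ _ _ (trans squares≡ (e p))
    where e : ∀ p → (8 + p) * (8 + p) + 3 ≡ (6 + p + 2) * (6 + p + 2) + 3
          e = solve-∀
  max-excess≡2 (suc (suc (suc r))) _ squares≡ _ = contradiction (begin
    a * a + 3 + suc (13 + 2 * p + r * (18 + 2 * p + r)) ≡⟨ e p r ⟩
    M * M   ≤⟨ m≤m+n (M * M) _ ⟩
    M * M + _ ≡⟨ squares≡ ⟩
    a * a + 3 ∎) (m+1+n≰m _)
    where open ≤-Reasoning
          M = 6 + p + suc (suc (suc r))
          e : ∀ p r → (8 + p) * (8 + p) + 3 + suc (13 + 2 * p + r * (18 + 2 * p + r)) ≡ (6 + p + suc (suc (suc r))) * (6 + p + suc (suc (suc r)))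
          e = solve-∀

  excess+rest≡5 : ∀ r {s} → 6 + p + r + s ≡ a + 3 → r + s ≡ 5
  excess+rest≡5 r {s} sum≡ = +-cancelˡ-≡ (6 + p) _ _ (trans (sym (+-assoc (6 + p) r s)) (trans sum≡ (e p)))
    where e : ∀ p → 8 + p + 3 ≡ 6 + p + 5
          e = solve-∀

  max-profile : ∀ {M s q} → M + s ≡ a + 3 → M * M + q ≡ a * a + 3 → q ≤ M * s → q ≤ s * s →
                   M ≡ a × s ≡ 3 × q ≡ 3
  max-profile {M} sum≡ squares≡ q≤Ms q≤s²
    with r , refl ← m≤n⇒∃[o]m+o≡n {6 + p} {M} (max-lower-bound sum≡ squares≡ q≤Ms)
    with refl , q≡3 ← max-excess≡2 r (excess+rest≡5 r sum≡) squares≡ q≤s²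
       = +-comm (6 + p) 2 , suc-injective (suc-injective (excess+rest≡5 2 sum≡)) , q≡3

  four-moments-profile : (u : Fin 4 → ℕ) → sum u ≡ a + 3 → sum (λ i → u i * u i) ≡ a * a + 3 →
                       ∃ λ t → u t ≡ a × (∀ s → s ≢ t → u s ≡ 1)
  four-moments-profile u sum≡ squares≡ = t , M≡a , others
    where
    t = proj₁ (∃-argmax u)
    w = removeAt u t
    profile = max-profile (trans (sym (sum-remove u)) sum≡)
                             (trans (sym (sum-remove (λ i → u i * u i))) squares≡)
                             (∑-sq≤max*∑ w (u t) (proj₂ (∃-argmax u) ∘ punchIn t))
                             (∑-sq≤sq-∑ w)
    M≡a = proj₁ profile
    others : ∀ s → s ≢ t → u s ≡ 1
    others s s≢t = subst (λ j → u j ≡ 1) (punchIn-punchOut (s≢t ∘ sym))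
                         (∑≡∑sq≡size⇒≡1 w (proj₁ (proj₂ profile)) (proj₂ (proj₂ profile)) _)

module DDGProperties {v k λ₁ λ₂ m n} {G : Graph v} {cls : Fin v → Fin m}
                     (ddg : IsDDG G k λ₁ λ₂ m n cls) where
  open IsDDG ddg

  A : Fin v → Fin v → ℕ
  A x z = χ (adj G x z)

  inClass : Fin v → Fin m → ℕ
  inClass z t = χ ⌊ cls z ≟ t ⌋

  N : Fin v → Fin m → ℕ
  N = nbrsIn G cls

  A-sym : ∀ x y → A x y ≡ A y x
  A-sym x y = cong χ (symm G x y)

  N≡∑ : ∀ x t → N x t ≡ sum (λ z → A x z * inClass z t)
  N≡∑ x t = trans (count≡∑χ (λ z → adj G x z ∧ ⌊ cls z ≟ t ⌋)) (sum-cong-≗ (λ z → χ-∧ (adj G x z) _))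

  common≡∑ : ∀ x y → common G x y ≡ sum (λ z → A x z * A y z)
  common≡∑ x y = trans (count≡∑χ (λ z → adj G x z ∧ adj G y z)) (sum-cong-≗ (λ z → χ-∧ (adj G x z) (adj G y z)))

  ∑-A : ∀ x → sum (A x) ≡ k
  ∑-A x = trans (sym (count≡∑χ (adj G x))) (regular x)

  common-self : ∀ x → common G x x ≡ k
  common-self x = trans (count≡∑χ (λ z → adj G x z ∧ adj G x z)) (trans (sum-cong-≗ (λ z → cong χ (∧-idem (adj G x z)))) (∑-A x))

  ∑-inClass : ∀ t → sum (λ z → inClass z t) ≡ n
  ∑-inClass t = trans (sym (count≡∑χ (λ z → ⌊ cls z ≟ t ⌋))) (classSize t)

  common-formula : ∀ y z → common G z y + λ₁ * χ ⌊ y ≟ z ⌋ + λ₂ * inClass z (cls y) ≡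
                           k * χ ⌊ y ≟ z ⌋ + λ₁ * inClass z (cls y) + λ₂
  common-formula y z with y ≟ z | cls z ≟ cls y
  ... | yes refl | yes _    = trans (cong (λ c → c + λ₁ * 1 + λ₂ * 1) (common-self y)) (e k λ₁ λ₂)
    where e : ∀ k a b → k + a * 1 + b * 1 ≡ k * 1 + a * 1 + b
          e = solve-∀
  ... | yes refl | no ≢cls  = contradiction refl ≢cls
  ... | no y≢z   | yes same = trans (cong (λ c → c + λ₁ * 0 + λ₂ * 1) (sameClass z y (y≢z ∘ sym) same)) (e k λ₁ λ₂)
    where e : ∀ k a b → a + a * 0 + b * 1 ≡ k * 0 + a * 1 + b
          e = solve-∀
  ... | no _     | no diff  = trans (cong (λ c → c + λ₁ * 0 + λ₂ * 0) (diffClass z y diff)) (e k λ₁ λ₂)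
    where e : ∀ k a b → b + a * 0 + b * 0 ≡ k * 0 + a * 0 + b
          e = solve-∀

  walks₃ : Fin v → Fin v → ℕ
  walks₃ x y = sum (λ z → A x z * common G z y)

  walks₃-sym : ∀ x y → walks₃ x y ≡ walks₃ y x
  walks₃-sym x y = begin
    sum (λ z → A x z * common G z y)                   ≡⟨ sum-cong-≗ (λ z → cong (A x z *_) (common≡∑ z y)) ⟩
    sum (λ z → A x z * sum (λ w → A z w * A y w))      ≡⟨ sum-cong-≗ (λ z → sym (∑-*ˡ (A x z) (λ w → A z w * A y w))) ⟩
    sum (λ z → sum (λ w → A x z * (A z w * A y w)))    ≡⟨ ∑-comm (λ z w → A x z * (A z w * A y w)) ⟩
    sum (λ w → sum (λ z → A x z * (A z w * A y w)))    ≡⟨ sum-cong-≗ (λ w → sum-cong-≗ (λ z → reorder z w)) ⟩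
    sum (λ w → sum (λ z → A y w * (A w z * A x z)))    ≡⟨ sum-cong-≗ (λ w → ∑-*ˡ (A y w) (λ z → A w z * A x z)) ⟩
    sum (λ w → A y w * sum (λ z → A w z * A x z))      ≡⟨ sum-cong-≗ (λ w → cong (A y w *_) (common≡∑ w x)) ⟨
    sum (λ w → A y w * common G w x)                   ∎
    where
    open ≡-Reasoning
    reorder : ∀ z w → A x z * (A z w * A y w) ≡ A y w * (A w z * A x z)
    reorder z w = trans (cong (λ a → A x z * (a * A y w)) (A-sym z w)) (e (A x z) (A w z) (A y w))
      where e : ∀ a b c → a * (b * c) ≡ c * (b * a)
            e = solve-∀

  walks₃-formula : ∀ x y → walks₃ x y + λ₁ * A x y + λ₂ * N x (cls y) ≡
                           k * A x y + λ₂ * k + λ₁ * N x (cls y)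
  walks₃-formula x y = begin
    walks₃ x y + λ₁ * A x y + λ₂ * N x (cls y)
      ≡⟨ cong₂ (λ a b → walks₃ x y + λ₁ * a + λ₂ * b) (sym (∑-sift (A x) y)) (N≡∑ x (cls y)) ⟩
    walks₃ x y + λ₁ * sum (λ z → A x z * δ z) + λ₂ * sum (λ z → A x z * inClass z (cls y))
      ≡⟨ ∑-linear₃ (λ z → A x z * common G z y) _ _ λ₁ λ₂ ⟨
    sum (λ z → A x z * common G z y + λ₁ * (A x z * δ z) + λ₂ * (A x z * inClass z (cls y)))
      ≡⟨ sum-cong-≗ (λ z → trans (sym (distrib-left (A x z) _ _ _ λ₁ λ₂))
                          (trans (cong (A x z *_) (common-formula y z)) (distrib-right (A x z) _ _ k λ₁ λ₂))) ⟩
    sum (λ z → k * (A x z * δ z) + λ₁ * (A x z * inClass z (cls y)) + λ₂ * A x z)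
      ≡⟨ ∑-linear₃ (λ z → k * (A x z * δ z)) _ (A x) λ₁ λ₂ ⟩
    sum (λ z → k * (A x z * δ z)) + λ₁ * sum (λ z → A x z * inClass z (cls y)) + λ₂ * sum (A x)
      ≡⟨ cong₃ (∑-*ˡ k (λ z → A x z * δ z)) (sym (N≡∑ x (cls y))) (∑-A x) ⟩
    k * sum (λ z → A x z * δ z) + λ₁ * N x (cls y) + λ₂ * k
      ≡⟨ cong (λ a → k * a + λ₁ * N x (cls y) + λ₂ * k) (∑-sift (A x) y) ⟩
    k * A x y + λ₁ * N x (cls y) + λ₂ * k
      ≡⟨ swap-last (k * A x y) _ _ ⟩
    k * A x y + λ₂ * k + λ₁ * N x (cls y) ∎
    where
    open ≡-Reasoning
    δ : Fin v → ℕ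
    δ z = χ ⌊ y ≟ z ⌋
    cong₃ : ∀ {a a′ b b′ c c′} → a ≡ a′ → b ≡ b′ → c ≡ c′ → a + λ₁ * b + λ₂ * c ≡ a′ + λ₁ * b′ + λ₂ * c′
    cong₃ refl refl refl = refl
    distrib-left : ∀ a c d e b₁ b₂ → a * (c + b₁ * d + b₂ * e) ≡ a * c + b₁ * (a * d) + b₂ * (a * e)
    distrib-left = solve-∀
    distrib-right : ∀ a d e k b₁ b₂ → a * (k * d + b₁ * e + b₂) ≡ k * (a * d) + b₁ * (a * e) + b₂ * a
    distrib-right = solve-∀
    swap-last : ∀ a b c → a + b + c ≡ a + c + b
    swap-last = solve-∀

  nbrsIn-sym : λ₁ ≢ λ₂ → ∀ x y → N x (cls y) ≡ N y (cls x)
  nbrsIn-sym λ₁≢λ₂ x y = lines-cross-once λ₁≢λ₂ (walks₃-formula x y) (begin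
    walks₃ x y + λ₁ * A x y + λ₂ * N y (cls x) ≡⟨ cong₂ (λ w a → w + λ₁ * a + λ₂ * N y (cls x)) (walks₃-sym x y) (A-sym x y) ⟩
    walks₃ y x + λ₁ * A y x + λ₂ * N y (cls x) ≡⟨ walks₃-formula y x ⟩
    k * A y x + λ₂ * k + λ₁ * N y (cls x)      ≡⟨ cong (λ a → k * a + λ₂ * k + λ₁ * N y (cls x)) (A-sym y x) ⟩
    k * A x y + λ₂ * k + λ₁ * N y (cls x)      ∎)
    where open ≡-Reasoning

  ∑-nbrsIn : ∀ x → sum (N x) ≡ k
  ∑-nbrsIn x = trans (sum-cong-≗ (N≡∑ x)) (trans (sym (∑-partition cls (A x))) (∑-A x))

  nbrsIn-≤ : ∀ x t → N x t ≤ n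
  nbrsIn-≤ x t = begin
    N x t                             ≡⟨ N≡∑ x t ⟩
    sum (λ z → A x z * inClass z t)   ≤⟨ ∑-mono-≤ (λ z → χ-*-≤ (adj G x z) (inClass z t)) ⟩
    sum (λ z → inClass z t)           ≡⟨ ∑-inClass t ⟩
    n                                 ∎
    where open ≤-Reasoning

  class-common-formula : ∀ x z → inClass z (cls x) * common G z x + λ₁ * χ ⌊ x ≟ z ⌋ ≡
                                 λ₁ * inClass z (cls x) + k * χ ⌊ x ≟ z ⌋
  class-common-formula x z with x ≟ z | cls z ≟ cls x
  ... | yes refl | yes _    = trans (cong (λ c → 1 * c + λ₁ * 1) (common-self x)) (e k λ₁)
    where e : ∀ k a → 1 * k + a * 1 ≡ a * 1 + k * 1
          e = solve-∀
  ... | yes refl | no ≢cls  = contradiction refl ≢cls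
  ... | no x≢z   | yes same = trans (cong (λ c → 1 * c + λ₁ * 0) (sameClass z x (x≢z ∘ sym) same)) (e k λ₁)
    where e : ∀ k a → 1 * a + a * 0 ≡ a * 1 + k * 0
          e = solve-∀
  ... | no _     | no _     = e (common G z x) k λ₁
    where e : ∀ c k a → 0 * c + a * 0 ≡ a * 0 + k * 0
          e = solve-∀

  ∑-nbrsIn² : λ₁ ≢ λ₂ → ∀ x → sum (λ t → N x t * N x t) + λ₁ ≡ k + λ₁ * n
  ∑-nbrsIn² λ₁≢λ₂ x = begin
    sum (λ t → N x t * N x t) + λ₁                              ≡⟨ cong₂ _+_ same-class-walks (*-identityʳ λ₁) ⟨
    sum (λ z → c z * common G z x) + λ₁ * 1                     ≡⟨ cong (λ a → sum (λ z → c z * common G z x) + λ₁ * a) (∑-δ x) ⟨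
    sum (λ z → c z * common G z x) + λ₁ * sum (λ z → δ z)       ≡⟨ ∑-+-*ˡ (λ z → c z * common G z x) δ λ₁ ⟨
    sum (λ z → c z * common G z x + λ₁ * δ z)                   ≡⟨ sum-cong-≗ (class-common-formula x) ⟩
    sum (λ z → λ₁ * c z + k * δ z)                              ≡⟨ ∑-+-*ˡ (λ z → λ₁ * c z) δ k ⟩
    sum (λ z → λ₁ * c z) + k * sum δ                            ≡⟨ cong₂ _+_ (∑-*ˡ λ₁ c) (cong (k *_) (∑-δ x)) ⟩
    λ₁ * sum c + k * 1                                          ≡⟨ cong₂ _+_ (cong (λ₁ *_) (∑-inClass (cls x))) (*-identityʳ k) ⟩
    λ₁ * n + k                                                  ≡⟨ +-comm (λ₁ * n) k ⟩
    k + λ₁ * n                                                  ∎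
    where
    open ≡-Reasoning
    c δ : Fin v → ℕ
    c z = inClass z (cls x)
    δ z = χ ⌊ x ≟ z ⌋
    reorder : ∀ z w → c z * (A z w * A x w) ≡ A x w * (A w z * c z)
    reorder z w = trans (cong (λ a → c z * (a * A x w)) (A-sym z w)) (e (c z) (A w z) (A x w))
      where e : ∀ a b d → a * (b * d) ≡ d * (b * a)
            e = solve-∀
    restrict : ∀ w t → A x w * N x (cls w) * inClass w t ≡ N x t * (A x w * inClass w t)
    restrict w t with cls w ≟ t
    ... | yes refl = e (A x w) (N x (cls w))
      where e : ∀ a b → a * b * 1 ≡ b * (a * 1)
            e = solve-∀
    ... | no _     = e (A x w) (N x (cls w)) (N x t)
      where e : ∀ a b d → a * b * 0 ≡ d * (a * 0)
            e = solve-∀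
    same-class-walks : sum (λ z → c z * common G z x) ≡ sum (λ t → N x t * N x t)
    same-class-walks = begin
      sum (λ z → c z * common G z x)                          ≡⟨ sum-cong-≗ (λ z → cong (c z *_) (common≡∑ z x)) ⟩
      sum (λ z → c z * sum (λ w → A z w * A x w))             ≡⟨ sum-cong-≗ (λ z → sym (∑-*ˡ (c z) (λ w → A z w * A x w))) ⟩
      sum (λ z → sum (λ w → c z * (A z w * A x w)))           ≡⟨ ∑-comm (λ z w → c z * (A z w * A x w)) ⟩
      sum (λ w → sum (λ z → c z * (A z w * A x w)))           ≡⟨ sum-cong-≗ (λ w → sum-cong-≗ (λ z → reorder z w)) ⟩
      sum (λ w → sum (λ z → A x w * (A w z * c z)))           ≡⟨ sum-cong-≗ (λ w → ∑-*ˡ (A x w) (λ z → A w z * c z)) ⟩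
      sum (λ w → A x w * sum (λ z → A w z * c z))             ≡⟨ sum-cong-≗ (λ w → cong (A x w *_) (N≡∑ w (cls x))) ⟨
      sum (λ w → A x w * N w (cls x))                         ≡⟨ sum-cong-≗ (λ w → cong (A x w *_) (nbrsIn-sym λ₁≢λ₂ w x)) ⟩
      sum (λ w → A x w * N x (cls w))                         ≡⟨ ∑-partition cls (λ w → A x w * N x (cls w)) ⟩
      sum (λ t → sum (λ w → A x w * N x (cls w) * inClass w t)) ≡⟨ sum-cong-≗ (λ t → sum-cong-≗ (λ w → restrict w t)) ⟩
      sum (λ t → sum (λ w → N x t * (A x w * inClass w t)))   ≡⟨ sum-cong-≗ (λ t → ∑-*ˡ (N x t) (λ w → A x w * inClass w t)) ⟩
      sum (λ t → N x t * sum (λ w → A x w * inClass w t))     ≡⟨ sum-cong-≗ (λ t → cong (N x t *_) (N≡∑ x t)) ⟨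
      sum (λ t → N x t * N x t)                               ∎

  class-inhabited : 0 < n → ∀ t → ∃ λ y → cls y ≡ t
  class-inhabited 0<n t =
    let y , y∈t = 0<count⇒∃ (λ z → ⌊ cls z ≟ t ⌋) (subst (0 <_) (sym (classSize t)) 0<n)
    in y , toWitness y∈t

  nbrsIn-equitable : λ₁ ≢ λ₂ → 0 < n → ∀ {x x′} → cls x ≡ cls x′ → ∀ t → N x t ≡ N x′ t
  nbrsIn-equitable λ₁≢λ₂ 0<n {x} {x′} same t with y , refl ← class-inhabited 0<n t = begin
    N x (cls y)  ≡⟨ nbrsIn-sym λ₁≢λ₂ x y ⟩
    N y (cls x)  ≡⟨ cong (N y) same ⟩
    N y (cls x′) ≡⟨ nbrsIn-sym λ₁≢λ₂ y x′ ⟩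
    N x′ (cls y) ∎
    where open ≡-Reasoning

Conjugate : ∀ {m} → (Fin m → Fin m) → (Fin m → Fin m) → Permutation′ m → Set
Conjugate g τ σ = ∀ i → g (σ ⟨$⟩ʳ i) ≡ σ ⟨$⟩ʳ τ i

τ₁ τ₂ τ₃ : Fin 4 → Fin 4
τ₁ = lookup (1F ∷ 0F ∷ 3F ∷ 2F ∷ [])
τ₂ = lookup (1F ∷ 0F ∷ 2F ∷ 3F ∷ [])
τ₃ = lookup (0F ∷ 1F ∷ 2F ∷ 3F ∷ [])

StandardForm : (Fin 4 → Fin 4) → Permutation′ 4 → Set
StandardForm g σ = Conjugate g τ₁ σ ⊎ (Conjugate g τ₂ σ ⊎ Conjugate g τ₃ σ)

standardForm? : ∀ g σ → Dec (StandardForm g σ)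
standardForm? g σ = conjugate? τ₁ ⊎-dec (conjugate? τ₂ ⊎-dec conjugate? τ₃)
  where conjugate? = λ τ → all? λ i → g (σ ⟨$⟩ʳ i) ≟ σ ⟨$⟩ʳ τ i

candidates : List (Permutation′ 4)
candidates = id ∷ transpose 1F 2F ∷ transpose 1F 3F ∷ transpose 0F 2F ∷ transpose 0F 3F
                ∷ (transpose 0F 2F ∘ₚ transpose 1F 3F) ∷ []

-- Checked by evaluation over all 4⁴ tables; opaque, because unfolding the
-- decision procedure during later unification problems is prohibitively slow.
opaque
  table-involutions : ∀ a b c d → let g = lookup (a ∷ b ∷ c ∷ d ∷ []) in
                      Involutive g → Any (StandardForm g) candidates
  table-involutions = toWitness {a? = all? λ a → all? λ b → all? λ c → all? λ d →
    let g = lookup (a ∷ b ∷ c ∷ d ∷ []) in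
    all? (λ i → g (g i) ≟ i) →-dec any? (standardForm? g) candidates} tt

standardMatrix : ℕ → (Fin 4 → Fin 4) → Fin 4 → Fin 4 → ℕ
standardMatrix n τ i j = if ⌊ j ≟ τ i ⌋ then 1 else n ∸ 1

∀-Fin4 : {P : Fin 4 → Set} → P 0F → P 1F → P 2F → P 3F → ∀ i → P i
∀-Fin4 p₀ p₁ p₂ p₃ 0F = p₀
∀-Fin4 p₀ p₁ p₂ p₃ 1F = p₁
∀-Fin4 p₀ p₁ p₂ p₃ 2F = p₂
∀-Fin4 p₀ p₁ p₂ p₃ 3F = p₃

R₁-standard : ∀ n i j → R₁ n i j ≡ standardMatrix n τ₁ i j
R₁-standard n = ∀-Fin4 (∀-Fin4 refl refl refl refl) (∀-Fin4 refl refl refl refl)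
                       (∀-Fin4 refl refl refl refl) (∀-Fin4 refl refl refl refl)

R₂-standard : ∀ n i j → R₂ n i j ≡ standardMatrix n τ₂ i j
R₂-standard n = ∀-Fin4 (∀-Fin4 refl refl refl refl) (∀-Fin4 refl refl refl refl)
                       (∀-Fin4 refl refl refl refl) (∀-Fin4 refl refl refl refl)

R₃-standard : ∀ n i j → R₃ n i j ≡ standardMatrix n τ₃ i j
R₃-standard n = ∀-Fin4 (∀-Fin4 refl refl refl refl) (∀-Fin4 refl refl refl refl)
                       (∀-Fin4 refl refl refl refl) (∀-Fin4 refl refl refl refl)

involution-standardForm : ∀ g → Involutive g → Σ (Permutation′ 4) (StandardForm g)
involution-standardForm g g-inv =
  let σ , form = satisfied (table-involutions (g 0F) (g 1F) (g 2F) (g 3F) table-inv)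
  in σ , Sum.map (from-table τ₁ σ) (Sum.map (from-table τ₂ σ) (from-table τ₃ σ)) form
  where
  table≗g : ∀ i → lookup (tabulate g) i ≡ g i
  table≗g = lookup∘tabulate g
  table-inv : Involutive (lookup (tabulate g))
  table-inv i = trans (table≗g _) (trans (cong g (table≗g i)) (g-inv i))
  from-table : ∀ τ σ → Conjugate (lookup (tabulate g)) τ σ → Conjugate g τ σ
  from-table τ σ conj i = trans (sym (table≗g _)) (conj i)

module Corollary (p : ℕ) {G : Graph (4 * (9 + p))} {cls : Fin (4 * (9 + p)) → Fin 4}
                 (ddg : IsDDG G (3 * (9 + p) ∸ 2) (3 * (9 + p) ∸ 6) (2 * (9 + p) ∸ 2) 4 (9 + p) cls) where
  open DDGProperties ddg

  private
    n = 9 + p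

  k≡ : 3 * n ∸ 2 ≡ 25 + 3 * p
  k≡ = trans (cong (_∸ 2) (e p)) (m+n∸m≡n 2 (25 + 3 * p))
    where e : ∀ p → 3 * (9 + p) ≡ 2 + (25 + 3 * p)
          e = solve-∀

  λ₁≡ : 3 * n ∸ 6 ≡ 21 + 3 * p
  λ₁≡ = trans (cong (_∸ 6) (e p)) (m+n∸m≡n 6 (21 + 3 * p))
    where e : ∀ p → 3 * (9 + p) ≡ 6 + (21 + 3 * p)
          e = solve-∀

  λ₁≢λ₂ : 3 * n ∸ 6 ≢ 2 * n ∸ 2
  λ₁≢λ₂ eq = m+1+n≢m (16 + 2 * p) (trans (e p) (trans (sym λ₁≡) (trans eq λ₂≡)))
    where
    e : ∀ p → 16 + 2 * p + suc (4 + p) ≡ 21 + 3 * p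
    e = solve-∀
    λ₂≡ : 2 * n ∸ 2 ≡ 16 + 2 * p
    λ₂≡ = trans (cong (_∸ 2) (e′ p)) (m+n∸m≡n 2 (16 + 2 * p))
      where e′ : ∀ p → 2 * (9 + p) ≡ 2 + (16 + 2 * p)
            e′ = solve-∀

  -- opaque: otherwise unification problems involving partner unfold this
  -- proof down to the counting functions over all 4n vertices
  opaque
    nbrsIn-profile : ∀ x → ∃ λ t → N x t ≡ 1 × (∀ s → s ≢ t → N x s ≡ 8 + p)
    nbrsIn-profile x =
      let t , ut≡ , us≡ = four-moments-profile p u ∑u ∑u² in
      t , +-cancelˡ-≡ (8 + p) _ _ (trans (complement ut≡) (+-comm 1 (8 + p)))
        , λ s s≢t → suc-injective (complement (us≡ s s≢t))
      where
      u : Fin 4 → ℕ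
      u s = n ∸ N x s
      complement : ∀ {s c} → u s ≡ c → c + N x s ≡ n
      complement refl = m∸n+n≡m (nbrsIn-≤ x _)
      ∑N : sum (N x) ≡ 25 + 3 * p
      ∑N = trans (∑-nbrsIn x) k≡
      ∑u : sum u ≡ 8 + p + 3
      ∑u = +-cancelʳ-≡ (25 + 3 * p) _ _ (begin
        sum u + (25 + 3 * p)     ≡⟨ cong (sum u +_) ∑N ⟨
        sum u + sum (N x)        ≡⟨ ∑-complement n (N x) (nbrsIn-≤ x) ⟩
        4 * n                    ≡⟨ e p ⟩
        8 + p + 3 + (25 + 3 * p) ∎)
        where
        open ≡-Reasoning
        e : ∀ p → 4 * (9 + p) ≡ 8 + p + 3 + (25 + 3 * p)
        e = solve-∀
      ∑u² : sum (λ s → u s * u s) ≡ (8 + p) * (8 + p) + 3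
      ∑u² = +-cancelʳ-≡ (2 * n * (25 + 3 * p) + (21 + 3 * p)) _ _ (begin
        sum (λ s → u s * u s) + (2 * n * (25 + 3 * p) + (21 + 3 * p))
          ≡⟨ cong₂ (λ a b → sum (λ s → u s * u s) + (2 * n * a + b)) ∑N λ₁≡ ⟨
        sum (λ s → u s * u s) + (2 * n * sum (N x) + (3 * n ∸ 6))
          ≡⟨ +-assoc (sum (λ s → u s * u s)) _ _ ⟨
        sum (λ s → u s * u s) + 2 * n * sum (N x) + (3 * n ∸ 6)
          ≡⟨ cong (_+ (3 * n ∸ 6)) (∑-complement-sq n (N x) (nbrsIn-≤ x)) ⟩
        4 * (n * n) + sum (λ s → N x s * N x s) + (3 * n ∸ 6)
          ≡⟨ +-assoc (4 * (n * n)) _ _ ⟩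
        4 * (n * n) + (sum (λ s → N x s * N x s) + (3 * n ∸ 6))
          ≡⟨ cong (4 * (n * n) +_) (∑-nbrsIn² λ₁≢λ₂ x) ⟩
        4 * (n * n) + ((3 * n ∸ 2) + (3 * n ∸ 6) * n)
          ≡⟨ cong₂ (λ a b → 4 * (n * n) + (a + b * n)) k≡ λ₁≡ ⟩
        4 * (n * n) + ((25 + 3 * p) + (21 + 3 * p) * n)
          ≡⟨ e p ⟩
        (8 + p) * (8 + p) + 3 + (2 * n * (25 + 3 * p) + (21 + 3 * p)) ∎)
        where
        open ≡-Reasoning
        e : ∀ p → 4 * ((9 + p) * (9 + p)) + ((25 + 3 * p) + (21 + 3 * p) * (9 + p)) ≡
                  (8 + p) * (8 + p) + 3 + (2 * (9 + p) * (25 + 3 * p) + (21 + 3 * p))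
        e = solve-∀

  representative : Fin 4 → Fin (4 * n)
  representative i = proj₁ (class-inhabited (s≤s z≤n) i)

  partner : Fin 4 → Fin 4
  partner i = proj₁ (nbrsIn-profile (representative i))

  nbrsIn-representative : ∀ x s → N x s ≡ N (representative (cls x)) s
  nbrsIn-representative x = nbrsIn-equitable λ₁≢λ₂ (s≤s z≤n) (sym (proj₂ (class-inhabited (s≤s z≤n) (cls x))))

  nbrsIn-partner : ∀ x → N x (partner (cls x)) ≡ 1
  nbrsIn-partner x = trans (nbrsIn-representative x _) (proj₁ (proj₂ (nbrsIn-profile (representative (cls x)))))

  nbrsIn-nonpartner : ∀ x s → s ≢ partner (cls x) → N x s ≡ 8 + p
  nbrsIn-nonpartner x s s≢ = trans (nbrsIn-representative x s) (proj₂ (proj₂ (nbrsIn-profile (representative (cls x)))) s s≢)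

  partner-unique : ∀ x s → N x s ≡ 1 → s ≡ partner (cls x)
  partner-unique x s Nxs≡1 = decidable-stable (s ≟ partner (cls x)) λ s≢ →
    contradiction (trans (sym (nbrsIn-nonpartner x s s≢)) Nxs≡1) λ ()

  partner-involutive : ∀ i → partner (partner i) ≡ i
  partner-involutive i = sym (begin
    i                        ≡⟨ partner-unique y i (begin
        N y i                ≡⟨ cong (N y) x∈i ⟨
        N y (cls x)          ≡⟨ nbrsIn-sym λ₁≢λ₂ x y ⟨
        N x (cls y)          ≡⟨ cong (N x) y∈ ⟩
        N x (partner i)      ≡⟨ cong (λ j → N x (partner j)) x∈i ⟨
        N x (partner (cls x)) ≡⟨ nbrsIn-partner x ⟩
        1                    ∎) ⟩
    partner (cls y)          ≡⟨ cong partner y∈ ⟩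
    partner (partner i)      ∎)
    where
    open ≡-Reasoning
    x = representative i
    y = representative (partner i)
    x∈i = proj₂ (class-inhabited (s≤s z≤n) i)
    y∈ = proj₂ (class-inhabited (s≤s z≤n) (partner i))

  quotient-standard : ∀ {τ σ} → Conjugate partner τ σ → HasQuotientMatrix G cls σ (standardMatrix n τ)
  quotient-standard {τ} {σ} conj i j x x∈σi = entry (j ≟ τ i)
    where
    partner≡ : partner (cls x) ≡ σ ⟨$⟩ʳ τ i
    partner≡ = trans (cong partner x∈σi) (conj i)
    entry : (d : Dec (j ≡ τ i)) → N x (σ ⟨$⟩ʳ j) ≡ (if ⌊ d ⌋ then 1 else 8 + p)
    entry (yes j≡τi) = trans (cong (λ k → N x (σ ⟨$⟩ʳ k)) j≡τi) (trans (cong (N x) (sym partner≡)) (nbrsIn-partner x))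
    entry (no  j≢τi) = nbrsIn-nonpartner x (σ ⟨$⟩ʳ j) (λ eq → j≢τi (Injection.injective (↔⇒↣ σ) (trans eq partner≡)))

  quotient-matrices : ∀ {σ} → StandardForm partner σ →
    HasQuotientMatrix G cls σ (R₁ n) ⊎ (HasQuotientMatrix G cls σ (R₂ n) ⊎ HasQuotientMatrix G cls σ (R₃ n))
  quotient-matrices {σ} = Sum.map (quotient (R₁-standard n)) (Sum.map (quotient (R₂-standard n)) (quotient (R₃-standard n)))
    where
    quotient : ∀ {R τ} → (∀ i j → R i j ≡ standardMatrix n τ i j) → Conjugate partner τ σ →
               HasQuotientMatrix G cls σ R
    quotient {τ = τ} R≡ conj i j x x∈σi = trans (quotient-standard {τ} {σ} conj i j x x∈σi) (sym (R≡ i j))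

  quotient-matrix : Σ (Permutation′ 4) (λ σ →
    HasQuotientMatrix G cls σ (R₁ n) ⊎
    (HasQuotientMatrix G cls σ (R₂ n) ⊎ HasQuotientMatrix G cls σ (R₃ n)))
  quotient-matrix =
    let σ , form = involution-standardForm partner partner-involutive in σ , quotient-matrices {σ} form

corollary2 : (n : ℕ) → n > 8 → (G : Graph (4 * n)) → (cls : Fin (4 * n) → Fin 4) →
    IsDDG G (3 * n ∸ 2) (3 * n ∸ 6) (2 * n ∸ 2) 4 n cls →
    Σ (Permutation′ 4) (λ σ →
      HasQuotientMatrix G cls σ (R₁ n) ⊎
      (HasQuotientMatrix G cls σ (R₂ n) ⊎ HasQuotientMatrix G cls σ (R₃ n)))
corollary2 n n>8 G cls ddg with p , refl ← m≤n⇒∃[o]m+o≡n n>8 = Corollary.quotient-matrix p ddg
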